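{- For all integers $c\geq 6$, $N(c,c)\geq \sqrt{5}^{\,c}$. Moreover, $N(5,5)\geq 55$ and $N(4,4)\geq 25$.
   Context: A normal cover of a graph $G$ is a pair $(\mathcal C,\mathcal S)$ where $\mathcal C$ is a set of cliques of $G$ covering every vertex, $\mathcal S$ is a set of stable sets of $G$ covering every vertex, and every clique in $\mathcal C$ meets every stable set in $\mathcal S$. A $(c,s)$-normal cover is a normal cover whose cliques have at most $c$ vertices and whose stable sets have at most $s$ vertices; a graph is $(c,s)$-normal if it admits one. $N(c,s)$ denotes the maximum number of vertices of a $(c,s)$-normal graph. -}

module Defs where

open import Data.Nat using (ℕ; _≤_; _^_; _*_)
open import Data.Bool using (Bool; true; false)
open import Data.Fin using (Fin)
open import Data.Fin.Subset using (Subset; _∈_; ∣_∣)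
open import Data.List using (List)
open import Data.List.Relation.Unary.Any using (Any)
open import Data.List.Relation.Unary.All using (All)
open import Data.Product using (Σ; ∃; _×_)
open import Relation.Binary.PropositionalEquality using (_≡_; _≢_)

record Graph (n : ℕ) : Set where
  field
    adj   : Fin n → Fin n → Bool
    sym   : ∀ u v → adj u v ≡ adj v u
    irrefl : ∀ v → adj v v ≡ false
open Graph public

IsClique : ∀ {n} → Graph n → Subset n → Set
IsClique G K = ∀ u v → u ∈ K → v ∈ K → u ≢ v → adj G u v ≡ true

IsStable : ∀ {n} → Graph n → Subset n → Set
IsStable G S = ∀ u v → u ∈ S → v ∈ S → adj G u v ≡ false

Covers : ∀ {n} → List (Subset n) → Set
Covers {n} F = ∀ (v : Fin n) → Any (v ∈_) F

Meet : ∀ {n} → Subset n → Subset n → Set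
Meet A B = ∃ λ v → v ∈ A × v ∈ B

record NormalCover {n} (c s : ℕ) (G : Graph n) : Set where
  field
    cliques  : List (Subset n)
    stables  : List (Subset n)
    cliquesAreCliques : All (IsClique G) cliques
    stablesAreStable  : All (IsStable G) stables
    cliquesSmall : All (λ K → ∣ K ∣ ≤ c) cliques
    stablesSmall : All (λ S → ∣ S ∣ ≤ s) stables
    cliquesCover : Covers cliques
    stablesCover : Covers stables
    meets : All (λ K → All (λ S → Meet K S) stables) cliques

IsNormal : ∀ {n} → ℕ → ℕ → Graph n → Set
IsNormal c s G = NormalCover c s G

-- "N(c,s) ≥ k": some (c,s)-normal graph has at least k vertices
-- (N(c,s) is the maximum number of vertices of a (c,s)-normal graph).
N≥ : ℕ → ℕ → ℕ → Set
N≥ c s k = Σ ℕ λ n → k ≤ n × Σ (Graph n) λ G → IsNormal c s G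

-- "N(c,s) ≥ √5^c", i.e. some (c,s)-normal graph on n vertices with
-- n ≥ √5^c, equivalently n² ≥ 5^c (n a natural number).
N≥√5^ : ℕ → ℕ → ℕ → Set
N≥√5^ c s e = Σ ℕ λ n → 5 ^ e ≤ n * n × Σ (Graph n) λ G → IsNormal c s G

module Submission where

-- Lower bounds for N(c,c) by iterating a "5-cycle blow-up".
--
-- Key step: let G be (c,s)-normal on n ≥ 1
-- vertices.  Take a 5-cycle a₀ … a₄ and five disjoint copies G₀ … G₄ of G,
-- and join every vertex of Gᵢ to the cycle edge {aᵢ, aᵢ₊₁}.  For a clique K
-- and a stable set S of the cover of G, the sets
--     {aᵢ, aᵢ₊₁} ∪ Kᵢ      and      {aⱼ₊₂, aⱼ₊₄} ∪ Sⱼ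
-- form a (c+2, s+2)-normal cover of the new graph, which has 5n + 5 vertices:
-- for i = j they meet inside Gᵢ, and for i ≠ j the edge {aᵢ, aᵢ₊₁} meets the
-- non-edge {aⱼ₊₂, aⱼ₊₄}.

open import Defs
open import Data.Nat using (ℕ; _≤_; suc; _+_; _*_; _^_; s≤s)
import Data.Nat as Nat
open import Data.Product using (_×_; Σ; ∃; _,_)
open import Data.Bool using (Bool; true; false; _∧_; _∨_)
import Data.Bool.Properties as Bool
open import Data.Empty using (⊥-elim)
open import Data.Fin using (Fin; zero; suc; toℕ; _↑ˡ_; _↑ʳ_; splitAt; combine; remQuot)
open import Data.Fin.Properties using (_≟_; all?; any?; splitAt-↑ˡ; splitAt-↑ʳ; splitAt⁻¹-↑ˡ; splitAt⁻¹-↑ʳ; remQuot-combine; combine-surjective)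
open import Data.Fin.Subset using (Subset; _∈_; _∉_; ∣_∣; ⊥; ⁅_⁆; _∪_; inside; outside)
open import Data.Fin.Subset.Properties using (_∈?_; ∉⊥; ∣⊥∣≡0)
open import Data.List using (List; []; _∷_; concatMap; tabulate)
open import Data.List.Relation.Unary.All as All using (All)
import Data.List.Relation.Unary.All.Properties as All
open import Data.List.Relation.Unary.Any as Any using (Any)
import Data.List.Relation.Unary.Any.Properties as Any
open import Data.Nat.DivMod using (_mod_)
open import Data.Nat.Properties using (+-identityʳ; ≤-refl; *-monoʳ-≤; *-mono-≤; m≤n+m; m≤n⇒∃[o]m+o≡n; module ≤-Reasoning)
open import Data.Nat.Tactic.RingSolver using (solve-∀)
import Data.Sum as Sum
open import Data.Sum using (_⊎_; inj₁; inj₂)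
open import Data.Vec using ([]; _∷_; _++_; here; there)
open import Function using (_∘_)
open import Relation.Binary.PropositionalEquality as ≡ using (_≡_; _≢_; refl; trans; cong; cong₂; subst)
open import Relation.Nullary using (Dec; yes; no; does; ¬?; _×-dec_; _→-dec_)
open import Relation.Nullary.Decidable using (True; toWitness; from-yes; dec-true; dec-false)

NormalGraph : ℕ → ℕ → ℕ → Set
NormalGraph c s n = Σ (Graph n) (NormalCover c s)

module _ {n : ℕ} (G : Graph n) where

  isClique? : (K : Subset n) → Dec (IsClique G K)
  isClique? K = all? λ u → all? λ v →
    u ∈? K →-dec v ∈? K →-dec ¬? (u ≟ v) →-dec adj G u v Bool.≟ true

  isStable? : (S : Subset n) → Dec (IsStable G S)
  isStable? S = all? λ u → all? λ v → u ∈? S →-dec v ∈? S →-dec adj G u v Bool.≟ false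

meet? : ∀ {n} (A B : Subset n) → Dec (Meet A B)
meet? A B = any? λ v → v ∈? A ×-dec v ∈? B

covers? : ∀ {n} (F : List (Subset n)) → Dec (Covers F)
covers? F = all? λ v → Any.any? (v ∈?_) F

module _ {n : ℕ} (c s : ℕ) (G : Graph n) (Ks Ss : List (Subset n)) where

  NormalConditions : Set
  NormalConditions =
    All (IsClique G) Ks × All (IsStable G) Ss ×
    All (λ K → ∣ K ∣ ≤ c) Ks × All (λ S → ∣ S ∣ ≤ s) Ss ×
    Covers Ks × Covers Ss × All (λ K → All (Meet K) Ss) Ks

  normalConditions? : Dec NormalConditions
  normalConditions? =
    All.all? (isClique? G) Ks ×-dec All.all? (isStable? G) Ss ×-dec
    All.all? (λ K → ∣ K ∣ Nat.≤? c) Ks ×-dec All.all? (λ S → ∣ S ∣ Nat.≤? s) Ss ×-dec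
    covers? Ks ×-dec covers? Ss ×-dec All.all? (λ K → All.all? (meet? K) Ss) Ks

  checkedCover : {True normalConditions?} → NormalCover c s G
  checkedCover {ok} with (cl , st , cs , ss , cc , sc , ms) ← toWitness ok = record
    { cliques = Ks ; stables = Ss
    ; cliquesAreCliques = cl ; stablesAreStable = st
    ; cliquesSmall = cs ; stablesSmall = ss
    ; cliquesCover = cc ; stablesCover = sc
    ; meets = ms }

_⊕_ : Fin 5 → ℕ → Fin 5
a ⊕ k = (toℕ a + k) mod 5

C₅ : Graph 5
C₅ = record
  { adj    = cyclic
  ; sym    = from-yes (all? λ a → all? λ b → cyclic a b Bool.≟ cyclic b a)
  ; irrefl = from-yes (all? λ a → cyclic a a Bool.≟ false) }
  where
  cyclic : Fin 5 → Fin 5 → Bool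
  cyclic a b = does (b ≟ a ⊕ 1) ∨ does (a ≟ b ⊕ 1)

edge gap : Fin 5 → Subset 5
edge i = ⁅ i ⁆ ∪ ⁅ i ⊕ 1 ⁆
gap j = ⁅ j ⊕ 2 ⁆ ∪ ⁅ j ⊕ 4 ⁆

edge-clique : ∀ i → IsClique C₅ (edge i)
edge-clique = from-yes (all? λ i → isClique? C₅ (edge i))

gap-stable : ∀ j → IsStable C₅ (gap j)
gap-stable = from-yes (all? λ j → isStable? C₅ (gap j))

gap-avoids-edge : ∀ j a → a ∈ gap j → a ∉ edge j
gap-avoids-edge = from-yes (all? λ j → all? λ a → a ∈? gap j →-dec ¬? (a ∈? edge j))

edge-meets-gap : ∀ i j → i ≢ j → Meet (edge i) (gap j)
edge-meets-gap = from-yes (all? λ i → all? λ j → ¬? (i ≟ j) →-dec meet? (edge i) (gap j))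

edge-covers : ∀ a → a ∈ edge a
edge-covers = from-yes (all? λ a → a ∈? edge a)

gap-covers : ∀ a → ∃ λ j → a ∈ gap j
gap-covers = from-yes (all? λ a → any? λ j → a ∈? gap j)

∣edge∣ : ∀ i → ∣ edge i ∣ ≡ 2
∣edge∣ = from-yes (all? λ i → ∣ edge i ∣ Nat.≟ 2)

∣gap∣ : ∀ j → ∣ gap j ∣ ≡ 2
∣gap∣ = from-yes (all? λ j → ∣ gap j ∣ Nat.≟ 2)

K₁-normal : NormalGraph 1 1 1
K₁-normal = K₁ , checkedCover 1 1 K₁ (⁅ zero ⁆ ∷ []) (⁅ zero ⁆ ∷ [])
  where
  K₁ : Graph 1
  K₁ = record { adj = λ _ _ → false ; sym = λ _ _ → refl ; irrefl = λ _ → refl }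

2K₂-normal : NormalGraph 2 2 4
2K₂-normal = 2K₂ , checkedCover 2 2 2K₂ edges stables
  where
  partner : Fin 4 → Fin 4
  partner zero = suc zero
  partner (suc zero) = zero
  partner (suc (suc zero)) = suc (suc (suc zero))
  partner (suc (suc (suc zero))) = suc (suc zero)

  matched : Fin 4 → Fin 4 → Bool
  matched u v = does (v ≟ partner u)

  2K₂ : Graph 4
  2K₂ = record
    { adj    = matched
    ; sym    = from-yes (all? λ u → all? λ v → matched u v Bool.≟ matched v u)
    ; irrefl = from-yes (all? λ u → matched u u Bool.≟ false) }

  edges stables : List (Subset 4)
  edges   = (inside ∷ inside ∷ outside ∷ outside ∷ []) ∷ (outside ∷ outside ∷ inside ∷ inside ∷ []) ∷ []
  stables = (inside ∷ outside ∷ inside ∷ outside ∷ []) ∷ (outside ∷ inside ∷ outside ∷ inside ∷ []) ∷ []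

∈-++ˡ⁺ : ∀ {m k} {p : Subset m} {q : Subset k} {x : Fin m} → x ∈ p → (x ↑ˡ k) ∈ (p ++ q)
∈-++ˡ⁺ here = here
∈-++ˡ⁺ (there x∈p) = there (∈-++ˡ⁺ x∈p)

∈-++ˡ⁻ : ∀ {m k} {p : Subset m} {q : Subset k} {x : Fin m} → (x ↑ˡ k) ∈ (p ++ q) → x ∈ p
∈-++ˡ⁻ {p = _ ∷ _} {x = zero} here = here
∈-++ˡ⁻ {p = _ ∷ _} {x = suc x} (there x∈p) = there (∈-++ˡ⁻ x∈p)

∈-++ʳ⁺ : ∀ {m k} (p : Subset m) {q : Subset k} {y : Fin k} → y ∈ q → (m ↑ʳ y) ∈ (p ++ q)
∈-++ʳ⁺ [] y∈q = y∈q
∈-++ʳ⁺ (_ ∷ p) y∈q = there (∈-++ʳ⁺ p y∈q)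

∈-++ʳ⁻ : ∀ {m k} (p : Subset m) {q : Subset k} {y : Fin k} → (m ↑ʳ y) ∈ (p ++ q) → y ∈ q
∈-++ʳ⁻ [] y∈q = y∈q
∈-++ʳ⁻ (_ ∷ p) (there y∈q) = ∈-++ʳ⁻ p y∈q

∣++∣ : ∀ {m k} (p : Subset m) (q : Subset k) → ∣ p ++ q ∣ ≡ ∣ p ∣ + ∣ q ∣
∣++∣ [] q = refl
∣++∣ (inside ∷ p) q = cong suc (∣++∣ p q)
∣++∣ (outside ∷ p) q = ∣++∣ p q

-- Fin (m * k) is m blocks of k vertices; inBlock i X is the copy of
-- X ⊆ Fin k inside block i, the vertex x of block i being combine i x.
inBlock : ∀ {m k} → Fin m → Subset k → Subset (m * k)
inBlock {suc m} zero X = X ++ ⊥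
inBlock {suc m} {k} (suc i) X = ⊥ {k} ++ inBlock i X

inBlock⁺ : ∀ {m k} (i : Fin m) {X : Subset k} {x : Fin k} → x ∈ X → combine i x ∈ inBlock i X
inBlock⁺ {suc m} zero x∈X = ∈-++ˡ⁺ x∈X
inBlock⁺ {suc m} {k} (suc i) x∈X = ∈-++ʳ⁺ (⊥ {k}) (inBlock⁺ i x∈X)

inBlock⁻ : ∀ {m k} (i j : Fin m) {X : Subset k} {x : Fin k} → combine j x ∈ inBlock i X → j ≡ i × x ∈ X
inBlock⁻ {suc m} zero zero x∈ = refl , ∈-++ˡ⁻ x∈
inBlock⁻ {suc m} {k} zero (suc j) {X} x∈ = ⊥-elim (∉⊥ (∈-++ʳ⁻ X x∈))
inBlock⁻ {suc m} (suc i) zero x∈ = ⊥-elim (∉⊥ (∈-++ˡ⁻ x∈))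
inBlock⁻ {suc m} {k} (suc i) (suc j) x∈ with j≡i , x∈X ← inBlock⁻ i j (∈-++ʳ⁻ (⊥ {k}) x∈) = cong suc j≡i , x∈X

∣inBlock∣ : ∀ {m k} (i : Fin m) (X : Subset k) → ∣ inBlock i X ∣ ≡ ∣ X ∣
∣inBlock∣ {suc m} {k} zero X = begin
  ∣ X ++ ⊥ ∣             ≡⟨ ∣++∣ X ⊥ ⟩
  ∣ X ∣ + ∣ ⊥ {m * k} ∣ ≡⟨ cong (∣ X ∣ +_) (∣⊥∣≡0 (m * k)) ⟩
  ∣ X ∣ + 0             ≡⟨ +-identityʳ ∣ X ∣ ⟩
  ∣ X ∣                 ∎
  where open ≡.≡-Reasoning
∣inBlock∣ {suc m} {k} (suc i) X = trans (∣++∣ (⊥ {k}) (inBlock i X)) (cong₂ _+_ (∣⊥∣≡0 k) (∣inBlock∣ i X))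

spread : ∀ {A B : Set} {k} → (Fin k → A → B) → List A → List B
spread F = concatMap λ X → tabulate λ i → F i X

spread-all : ∀ {A B : Set} {k} {P : A → Set} {Q : B → Set} (F : Fin k → A → B) →
  (∀ i {X} → P X → Q (F i X)) → ∀ {Xs} → All P Xs → All Q (spread F Xs)
spread-all F preserve ps = All.concat⁺ (All.map⁺ (All.map (λ p → All.tabulate⁺ λ i → preserve i p) ps))

spread-any : ∀ {A B : Set} {k} {P : A → Set} {Q : B → Set} (F : Fin k → A → B) (i : Fin k) →
  (∀ {X} → P X → Q (F i X)) → ∀ {Xs} → Any P Xs → Any Q (spread F Xs)
spread-any F i preserve p = Any.concat⁺ (Any.map⁺ (Any.map (λ q → Any.tabulate⁺ i (preserve q)) p))

module Blowup {c s n : ℕ} (G : Graph n) (cover : NormalCover c s G) (x₀ : Fin n) where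
  open NormalCover cover

  cyc : Fin 5 → Fin (5 + 5 * n)
  cyc a = a ↑ˡ (5 * n)

  copy : Fin 5 → Fin n → Fin (5 + 5 * n)
  copy i x = 5 ↑ʳ combine i x

  data Vertex : Fin (5 + 5 * n) → Set where
    cycV  : (a : Fin 5) → Vertex (cyc a)
    copyV : (i : Fin 5) (x : Fin n) → Vertex (copy i x)

  vertex : ∀ u → Vertex u
  vertex u with splitAt 5 u in split
  ... | inj₁ a = subst Vertex (splitAt⁻¹-↑ˡ split) (cycV a)
  ... | inj₂ y with i , x , refl ← combine-surjective {5} {n} y = subst Vertex (splitAt⁻¹-↑ʳ split) (copyV i x)

  -- The computable counterpart of the view, used to define adjacency.
  decode : Fin (5 + 5 * n) → Fin 5 ⊎ (Fin 5 × Fin n)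
  decode u = Sum.map₂ (remQuot n) (splitAt 5 u)

  decode-cyc : ∀ a → decode (cyc a) ≡ inj₁ a
  decode-cyc a rewrite splitAt-↑ˡ 5 a (5 * n) = refl

  decode-copy : ∀ i x → decode (copy i x) ≡ inj₂ (i , x)
  decode-copy i x rewrite splitAt-↑ʳ 5 (5 * n) (combine i x) | remQuot-combine {5} {n} i x = refl

  link : Fin 5 ⊎ (Fin 5 × Fin n) → Fin 5 ⊎ (Fin 5 × Fin n) → Bool
  link (inj₁ a) (inj₁ b) = adj C₅ a b
  link (inj₁ a) (inj₂ (i , _)) = does (a ∈? edge i)
  link (inj₂ (i , _)) (inj₁ a) = does (a ∈? edge i)
  link (inj₂ (i , x)) (inj₂ (j , y)) = does (i ≟ j) ∧ adj G x y

  link-sym : ∀ p q → link p q ≡ link q p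
  link-sym (inj₁ a) (inj₁ b) = sym C₅ a b
  link-sym (inj₁ _) (inj₂ _) = refl
  link-sym (inj₂ _) (inj₁ _) = refl
  link-sym (inj₂ (i , x)) (inj₂ (j , y)) = cong₂ _∧_ (≟-symmetric i j) (sym G x y)
    where
    ≟-symmetric : ∀ (i j : Fin 5) → does (i ≟ j) ≡ does (j ≟ i)
    ≟-symmetric i j with i ≟ j | j ≟ i
    ... | yes _ | yes _ = refl
    ... | no  _ | no  _ = refl
    ... | yes i≡j | no j≢i = ⊥-elim (j≢i (≡.sym i≡j))
    ... | no i≢j | yes j≡i = ⊥-elim (i≢j (≡.sym j≡i))

  link-irrefl : ∀ p → link p p ≡ false
  link-irrefl (inj₁ a) = irrefl C₅ a
  link-irrefl (inj₂ (i , x)) rewrite irrefl G x = Bool.∧-zeroʳ (does (i ≟ i))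

  G⁺ : Graph (5 + 5 * n)
  G⁺ = record
    { adj    = λ u v → link (decode u) (decode v)
    ; sym    = λ u v → link-sym (decode u) (decode v)
    ; irrefl = λ u → link-irrefl (decode u) }

  adj-cyc : ∀ a b → adj G⁺ (cyc a) (cyc b) ≡ adj C₅ a b
  adj-cyc a b = cong₂ link (decode-cyc a) (decode-cyc b)

  adj-cyc-copy : ∀ a i x → adj G⁺ (cyc a) (copy i x) ≡ does (a ∈? edge i)
  adj-cyc-copy a i x = cong₂ link (decode-cyc a) (decode-copy i x)

  adj-copy : ∀ i x y → adj G⁺ (copy i x) (copy i y) ≡ adj G x y
  adj-copy i x y = begin
    adj G⁺ (copy i x) (copy i y) ≡⟨ cong₂ link (decode-copy i x) (decode-copy i y) ⟩
    does (i ≟ i) ∧ adj G x y     ≡⟨ cong (_∧ adj G x y) (dec-true (i ≟ i) refl) ⟩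
    adj G x y                    ∎
    where open ≡.≡-Reasoning

  cliqueOf stableOf : Fin 5 → Subset n → Subset (5 + 5 * n)
  cliqueOf i K = edge i ++ inBlock i K
  stableOf j S = gap j ++ inBlock j S

  copy⁻ : ∀ {L : Subset 5} (i j : Fin 5) {X : Subset n} {x : Fin n} → copy j x ∈ (L ++ inBlock i X) → j ≡ i × x ∈ X
  copy⁻ {L} i j x∈ = inBlock⁻ i j (∈-++ʳ⁻ L x∈)

  copy⁺ : ∀ (L : Subset 5) (i : Fin 5) {X : Subset n} {x : Fin n} → x ∈ X → copy i x ∈ (L ++ inBlock i X)
  copy⁺ L i x∈X = ∈-++ʳ⁺ L (inBlock⁺ i x∈X)

  lift-size : ∀ (L : Subset 5) (i : Fin 5) (X : Subset n) {b : ℕ} → ∣ L ∣ ≡ 2 → ∣ X ∣ ≤ b → ∣ L ++ inBlock i X ∣ ≤ 2 + b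
  lift-size L i X {b} ∣L∣≡2 ∣X∣≤b = begin
    ∣ L ++ inBlock i X ∣    ≡⟨ ∣++∣ L (inBlock i X) ⟩
    ∣ L ∣ + ∣ inBlock i X ∣ ≡⟨ cong₂ _+_ ∣L∣≡2 (∣inBlock∣ i X) ⟩
    2 + ∣ X ∣               ≤⟨ s≤s (s≤s ∣X∣≤b) ⟩
    2 + b                   ∎
    where open ≤-Reasoning

  cliqueOf-clique : ∀ i {K} → IsClique G K → IsClique G⁺ (cliqueOf i K)
  cliqueOf-clique i {K} K-clique u v u∈ v∈ u≢v with vertex u | vertex v
  ... | cycV a | cycV b =
    trans (adj-cyc a b) (edge-clique i a b (∈-++ˡ⁻ u∈) (∈-++ˡ⁻ v∈) (u≢v ∘ cong cyc))
  ... | cycV a | copyV j y with refl , _ ← copy⁻ i j v∈ =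
    trans (adj-cyc-copy a i y) (dec-true (a ∈? edge i) (∈-++ˡ⁻ u∈))
  ... | copyV j x | cycV b with refl , _ ← copy⁻ i j u∈ =
    trans (sym G⁺ (copy i x) (cyc b)) (trans (adj-cyc-copy b i x) (dec-true (b ∈? edge i) (∈-++ˡ⁻ v∈)))
  ... | copyV j x | copyV j′ y with refl , x∈K ← copy⁻ i j u∈ | refl , y∈K ← copy⁻ i j′ v∈ =
    trans (adj-copy i x y) (K-clique x y x∈K y∈K (u≢v ∘ cong (copy i)))

  stableOf-stable : ∀ j {S} → IsStable G S → IsStable G⁺ (stableOf j S)
  stableOf-stable j {S} S-stable u v u∈ v∈ with vertex u | vertex v
  ... | cycV a | cycV b =
    trans (adj-cyc a b) (gap-stable j a b (∈-++ˡ⁻ u∈) (∈-++ˡ⁻ v∈))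
  ... | cycV a | copyV i y with refl , _ ← copy⁻ j i v∈ =
    trans (adj-cyc-copy a j y) (dec-false (a ∈? edge j) (gap-avoids-edge j a (∈-++ˡ⁻ u∈)))
  ... | copyV i x | cycV b with refl , _ ← copy⁻ j i u∈ =
    trans (sym G⁺ (copy j x) (cyc b)) (trans (adj-cyc-copy b j x) (dec-false (b ∈? edge j) (gap-avoids-edge j b (∈-++ˡ⁻ v∈))))
  ... | copyV i x | copyV i′ y with refl , x∈S ← copy⁻ j i u∈ | refl , y∈S ← copy⁻ j i′ v∈ =
    trans (adj-copy j x y) (S-stable x y x∈S y∈S)

  -- For i = j the sets meet inside copy i; otherwise on the cycle.
  cliqueOf-meets-stableOf : ∀ i j {K S} → Meet K S → Meet (cliqueOf i K) (stableOf j S)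
  cliqueOf-meets-stableOf i j (x , x∈K , x∈S) with i ≟ j
  ... | yes refl = copy i x , copy⁺ (edge i) i x∈K , copy⁺ (gap i) i x∈S
  ... | no i≢j with a , a∈edge , a∈gap ← edge-meets-gap i j i≢j = cyc a , ∈-++ˡ⁺ a∈edge , ∈-++ˡ⁺ a∈gap

  -- Cycle vertices are covered through a clique and a stable set containing x₀.
  cliques⁺-cover : Covers (spread cliqueOf cliques)
  cliques⁺-cover u with vertex u
  ... | cycV a = spread-any cliqueOf a (λ _ → ∈-++ˡ⁺ (edge-covers a)) (cliquesCover x₀)
  ... | copyV i x = spread-any cliqueOf i (copy⁺ (edge i) i) (cliquesCover x)

  stables⁺-cover : Covers (spread stableOf stables)
  stables⁺-cover u with vertex u
  ... | cycV a with j , a∈gap ← gap-covers a = spread-any stableOf j (λ _ → ∈-++ˡ⁺ a∈gap) (stablesCover x₀)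
  ... | copyV i x = spread-any stableOf i (copy⁺ (gap i) i) (stablesCover x)

  cover⁺ : NormalCover (2 + c) (2 + s) G⁺
  cover⁺ = record
    { cliques = spread cliqueOf cliques
    ; stables = spread stableOf stables
    ; cliquesAreCliques = spread-all cliqueOf cliqueOf-clique cliquesAreCliques
    ; stablesAreStable  = spread-all stableOf stableOf-stable stablesAreStable
    ; cliquesSmall = spread-all cliqueOf (λ i {K} → lift-size (edge i) i K (∣edge∣ i)) cliquesSmall
    ; stablesSmall = spread-all stableOf (λ j {S} → lift-size (gap j) j S (∣gap∣ j)) stablesSmall
    ; cliquesCover = cliques⁺-cover
    ; stablesCover = stables⁺-cover
    ; meets = spread-all cliqueOf (λ i K-meets → spread-all stableOf (λ j → cliqueOf-meets-stableOf i j) K-meets) meets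
    }

blowup : ∀ {c s n} → Fin n → NormalGraph c s n → NormalGraph (2 + c) (2 + s) (5 + 5 * n)
blowup x₀ (G , cover) = Blowup.G⁺ G cover x₀ , Blowup.cover⁺ G cover x₀

order : ℕ → ℕ
order 0 = 1
order 1 = 4
order (suc (suc c)) = 5 + 5 * order c

normalGraph : ∀ c → NormalGraph (suc c) (suc c) (order c)
normalGraph 0 = K₁-normal
normalGraph 1 = 2K₂-normal
normalGraph (suc (suc c)) = blowup (aVertex c) (normalGraph c)
  where
  aVertex : ∀ c → Fin (order c)
  aVertex 0 = zero
  aVertex 1 = zero
  aVertex (suc (suc c)) = zero

-- Counting: every blow-up multiplies the squared order by at least 25,
-- so from c = 6 on the squared order stays above 5^c.

square-scale : ∀ m → 5 * (5 * (m * m)) ≡ (5 * m) * (5 * m)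
square-scale = solve-∀

growth-step : ∀ {k m} → 5 ^ k ≤ m * m → 5 ^ (2 + k) ≤ (5 + 5 * m) * (5 + 5 * m)
growth-step {k} {m} 5^k≤m² = begin
  5 * (5 * 5 ^ k)           ≤⟨ *-monoʳ-≤ 5 (*-monoʳ-≤ 5 5^k≤m²) ⟩
  5 * (5 * (m * m))         ≡⟨ square-scale m ⟩
  (5 * m) * (5 * m)         ≤⟨ *-mono-≤ (m≤n+m (5 * m) 5) (m≤n+m (5 * m) 5) ⟩
  (5 + 5 * m) * (5 + 5 * m) ∎
  where open ≤-Reasoning

growth : ∀ k → 5 ^ (6 + k) ≤ order (5 + k) * order (5 + k)
growth 0 = from-yes (5 ^ 6 Nat.≤? 130 * 130)
growth 1 = from-yes (5 ^ 7 Nat.≤? 280 * 280)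
growth (suc (suc k)) = growth-step {6 + k} {order (5 + k)} (growth k)

theorem2 : ((c : ℕ) → 6 ≤ c → N≥√5^ c c c) × N≥ 5 5 55 × N≥ 4 4 25
theorem2 = large , (order 4 , ≤-refl , normalGraph 4) , (order 3 , ≤-refl , normalGraph 3)
  where
  large : (c : ℕ) → 6 ≤ c → N≥√5^ c c c
  large c 6≤c with k , refl ← m≤n⇒∃[o]m+o≡n 6≤c = order (5 + k) , growth k , normalGraph (5 + k)
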